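{- Let $X$ be a finite set and let $S\subseteq\mathcal{P}(X)$ be intersection-closed with $|S|>1$ and $\emptyset,X_S\in S$, where $X_S=\bigcup_{A\in S}A$. For $p\in X_S$ write $S_p=\{A\in S: p\in A\}$. Then $p\in X_S$ satisfies $|S_p|\leq\frac{|S|}{2}$ if and only if there is an intersection-closed set $\hat S\subseteq S$ with $\emptyset,X_S\in\hat S$ such that $|\hat S_p|=\frac{|\hat S|}{2}$ and $p\notin A$ for every $A\in S\setminus\hat S$.
   Context: A family $S$ of sets is intersection-closed if $A\cap B\in S$ for all $A,B\in S$. For any family $T$, $T_p=\{A\in T:p\in A\}$. -}

module Defs where

open import Data.Nat using (ℕ)
open import Data.Fin using (Fin)
open import Data.List using (List; filter; length)
open import Data.Fin.Subset using (Subset; _∩_; ⋃; ⊥) renaming (_∈_ to _∈ₛ_)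
open import Data.Fin.Subset.Properties using (_∈?_)
open import Data.List.Membership.Propositional using (_∈_)
open import Data.List.Relation.Unary.Unique.Propositional using (Unique)

-- A family of subsets of the finite set X = Fin n: a duplicate-free list of subsets.
record Family (n : ℕ) : Set where
  constructor family
  field
    members : List (Subset n)
    unique  : Unique members
open Family public

card : ∀ {n} → Family n → ℕ
card S = length (members S)

_∈F_ : ∀ {n} → Subset n → Family n → Set
A ∈F S = A ∈ members S

_⊆F_ : ∀ {n} → Family n → Family n → Set
T ⊆F S = ∀ {A} → A ∈F T → A ∈F S

IntersectionClosed : ∀ {n} → Family n → Set
IntersectionClosed S = ∀ {A B} → A ∈F S → B ∈F S → (A ∩ B) ∈F S

support : ∀ {n} → Family n → Subset n
support S = ⋃ (members S)

cardAt : ∀ {n} → Fin n → Family n → ℕ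
cardAt p T = length (filter (p ∈?_) (members T))

module Submission where

-- Proof idea.  Split S into P = S_p (members containing p) and
-- N = S ∖ S_p, so |S| = |P| + |N|.
--
-- (⇐) If Ŝ ⊆ S contains every member of S that contains p, then
--     |S_p| ≤ |Ŝ_p| and |Ŝ| ≤ |S|, so 2|S_p| ≤ 2|Ŝ_p| = |Ŝ| ≤ |S|.
-- (⇒) If 2|P| ≤ |S| then |P| ≤ |N|.  Let T be |P| members of N of
--     smallest cardinality and Ŝ = P ∪ T.  Then Ŝ_p = P and |Ŝ| = 2|P|.
--     Ŝ is intersection-closed: P is, since S is and p ∈ A ∩ B; and if
--     B ∈ T then A ∩ B ∈ N is a subset of B, so it is either B or
--     strictly smaller, hence in T by the choice of T.  Since X_S ∈ P,
--     T is non-empty, and ∅ ⊆ B ∈ T gives ∅ ∈ T.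

open import Defs
open import Data.Nat using (ℕ; _≤_; _<_; _*_)
open import Data.Fin using (Fin)
open import Data.Product using (Σ; _×_)
open import Data.Fin.Subset using (Subset; ⊥) renaming (_∈_ to _∈ₛ_; _∉_ to _∉ₛ_)
open import Relation.Nullary using (¬_)
open import Relation.Binary.PropositionalEquality using (_≡_)
open import Function.Bundles using (_⇔_)

open import Data.Nat using (suc; _+_; z≤n; s≤s)
open import Data.Nat.Properties
  using (≤-reflexive; ≤-trans; ≤-decTotalOrder; +-suc; +-identityʳ; +-cancelˡ-≤; *-monoʳ-≤; m≤n⇒m⊓n≡m; <⇒≱; module ≤-Reasoning)
open import Data.Product using (_,_; proj₁; proj₂)
open import Data.Sum as Sum using (_⊎_; inj₁; inj₂)
open import Data.Empty using (⊥-elim)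
import Data.Bool.Properties as Bool
open import Data.Vec using ([]; _∷_; here)
open import Data.Vec.Properties using (≡-dec)
open import Data.List using (List; []; _∷_; length; filter; take; drop; _++_)
open import Data.List.Properties using (length-++; ++-identityʳ; filter-++; filter-all; filter-none; length-take; take++drop≡id)
open import Data.List.Membership.Propositional using (_∈_)
open import Data.List.Membership.Propositional.Properties
  using (∈-++⁺ˡ; ∈-++⁺ʳ; ∈-++⁻; ∈-∃++; ∈-filter⁺; ∈-filter⁻; ∈-length)
open import Data.List.Relation.Unary.Any using (here; there)
import Data.List.Relation.Unary.All as All
open import Data.List.Relation.Unary.All.Properties using (all-filter)
open import Data.List.Relation.Unary.AllPairs using (AllPairs; _∷_)
open import Data.List.Relation.Unary.Unique.Propositional using (Unique)
import Data.List.Relation.Unary.Unique.Propositional.Properties as Unique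
import Data.List.Relation.Unary.Sorted.TotalOrder.Properties as Sorted
open import Data.List.Relation.Binary.Permutation.Propositional using (↭-sym; ↭⇒↭ₛ)
open import Data.List.Relation.Binary.Permutation.Propositional.Properties using (↭-length; ∈-resp-↭)
import Data.List.Relation.Binary.Permutation.Setoid.Properties as PermutationSetoid
import Data.List.Sort as Sort
open import Data.Fin.Subset using (_∩_; _⊆_; _⊂_; ∣_∣; inside; outside)
open import Data.Fin.Subset.Properties
  using (_∈?_; p∩q⊆p; p∩q⊆q; x∈p∩q⁺; ⊥⊆; drop-∷-⊆; s⊂s; out⊂in; p⊂q⇒∣p∣<∣q∣)
open import Relation.Nullary using (contradiction; yes; no)
open import Relation.Unary using (Pred; Decidable)
open import Relation.Unary.Properties using (∁?)
open import Relation.Binary.PropositionalEquality using (refl; sym; trans; cong; cong₂; subst; setoid; module ≡-Reasoning)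
open import Relation.Binary.Bundles using (DecTotalOrder)
import Relation.Binary.Construct.On as On
open import Level using (0ℓ)
open import Function.Base using (_∘_)
open import Function.Bundles using (mk⇔)

module _ {A : Set} where

  unique-⊆-length : ∀ (xs ys : List A) → Unique xs → (∀ {z} → z ∈ xs → z ∈ ys)
                  → length xs ≤ length ys
  unique-⊆-length []       ys _ _ = z≤n
  unique-⊆-length (x ∷ xs) ys (x∉xs ∷ xs!) xs⊆ys
    with before , after , refl ← ∈-∃++ (xs⊆ys (here refl)) = begin
      suc (length xs)                   ≤⟨ s≤s (unique-⊆-length xs (before ++ after) xs! xs⊆rest) ⟩
      suc (length (before ++ after))    ≡⟨ cong suc (length-++ before) ⟩
      suc (length before + length after) ≡⟨ sym (+-suc (length before) (length after)) ⟩
      length before + length (x ∷ after) ≡⟨ sym (length-++ before) ⟩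
      length (before ++ x ∷ after)      ∎
    where
      open ≤-Reasoning
      xs⊆rest : ∀ {z} → z ∈ xs → z ∈ before ++ after
      xs⊆rest z∈xs with ∈-++⁻ before (xs⊆ys (there z∈xs))
      ... | inj₁ z∈before       = ∈-++⁺ˡ z∈before
      ... | inj₂ (here refl)    = ⊥-elim (All.lookup x∉xs z∈xs refl)
      ... | inj₂ (there z∈after) = ∈-++⁺ʳ before z∈after

  length-filter-∁ : ∀ {ℓ} {P : Pred A ℓ} (P? : Decidable P) xs
                  → length (filter P? xs) + length (filter (∁? P?) xs) ≡ length xs
  length-filter-∁ P? []       = refl
  length-filter-∁ P? (x ∷ xs) with P? x
  ... | yes _ = cong suc (length-filter-∁ P? xs)
  ... | no  _ = trans (+-suc _ _) (cong suc (length-filter-∁ P? xs))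

  allPairs-++ : ∀ {ℓ} {R : A → A → Set ℓ} xs {ys} → AllPairs R (xs ++ ys)
              → ∀ {x y} → x ∈ xs → y ∈ ys → R x y
  allPairs-++ (_ ∷ xs) (Rx ∷ _) (here refl) y∈ys = All.lookup Rx (∈-++⁺ʳ xs y∈ys)
  allPairs-++ (_ ∷ xs) (_ ∷ R-rest) (there x∈xs) y∈ys = allPairs-++ xs R-rest x∈xs y∈ys

module _ {A : Set} (w : A → ℕ) where

  record Lightest (xs : List A) (k : ℕ) : Set where
    field
      chosen        : List A
      chosen-unique : Unique chosen
      chosen-⊆      : ∀ {x} → x ∈ chosen → x ∈ xs
      chosen-length : length chosen ≡ k
      chosen-down   : ∀ {x y} → x ∈ chosen → y ∈ xs → w y < w x → y ∈ chosen

  lightest : ∀ (xs : List A) k → Unique xs → k ≤ length xs → Lightest xs k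
  lightest xs k xs! k≤|xs| = record
    { chosen        = take k sorted
    ; chosen-unique = Unique.take⁺ k sorted!
    ; chosen-⊆      = λ x∈ → ∈-resp-↭ (sort-↭ xs) (∈-sorted x∈)
    ; chosen-length = trans (length-take k sorted) (m≤n⇒m⊓n≡m (≤-trans k≤|xs| (≤-reflexive |xs|≡|sorted|)))
    ; chosen-down   = down
    }
    where
      byWeight : DecTotalOrder 0ℓ 0ℓ 0ℓ
      byWeight = On.decTotalOrder ≤-decTotalOrder w
      open Sort byWeight using (sort; sort-↭; sort-↗)
      sorted : List A
      sorted = sort xs
      |xs|≡|sorted| : length xs ≡ length sorted
      |xs|≡|sorted| = sym (↭-length (sort-↭ xs))
      sorted! : Unique sorted
      sorted! = PermutationSetoid.Unique-resp-↭ (setoid A) (↭⇒↭ₛ (↭-sym (sort-↭ xs))) xs!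
      split : take k sorted ++ drop k sorted ≡ sorted
      split = take++drop≡id k sorted
      ∈-sorted : ∀ {x} → x ∈ take k sorted → x ∈ sorted
      ∈-sorted x∈ = subst (_ ∈_) split (∈-++⁺ˡ x∈)
      prefix≤suffix : ∀ {x y} → x ∈ take k sorted → y ∈ drop k sorted → w x ≤ w y
      prefix≤suffix = allPairs-++ (take k sorted)
        (subst (AllPairs _) (sym split) (Sorted.Sorted⇒AllPairs (DecTotalOrder.totalOrder byWeight) (sort-↗ xs)))
      down : ∀ {x y} → x ∈ take k sorted → y ∈ xs → w y < w x → y ∈ take k sorted
      down x∈ y∈xs wy<wx with ∈-++⁻ (take k sorted) (subst (_ ∈_) (sym split) (∈-resp-↭ (↭-sym (sort-↭ xs)) y∈xs))
      ... | inj₁ y∈prefix = y∈prefix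
      ... | inj₂ y∈suffix = contradiction (prefix≤suffix x∈ y∈suffix) (<⇒≱ wy<wx)

⊆⇒≡⊎⊂ : ∀ {n} {C B : Subset n} → C ⊆ B → C ≡ B ⊎ C ⊂ B
⊆⇒≡⊎⊂ {C = []}          {[]}          _   = inj₁ refl
⊆⇒≡⊎⊂ {C = outside ∷ C} {inside  ∷ B} C⊆B = inj₂ (out⊂in (drop-∷-⊆ C⊆B))
⊆⇒≡⊎⊂ {C = inside  ∷ C} {outside ∷ B} C⊆B = contradiction (C⊆B here) λ ()
⊆⇒≡⊎⊂ {C = outside ∷ C} {outside ∷ B} C⊆B = Sum.map (cong (outside ∷_)) s⊂s (⊆⇒≡⊎⊂ (drop-∷-⊆ C⊆B))
⊆⇒≡⊎⊂ {C = inside  ∷ C} {inside  ∷ B} C⊆B = Sum.map (cong (inside ∷_)) s⊂s (⊆⇒≡⊎⊂ (drop-∷-⊆ C⊆B))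

lightest-⊆-closed : ∀ {n} {xs : List (Subset n)} {k} (L : Lightest ∣_∣ xs k)
                  → ∀ {B C} → B ∈ Lightest.chosen L → C ∈ xs → C ⊆ B → C ∈ Lightest.chosen L
lightest-⊆-closed L B∈ C∈xs C⊆B with ⊆⇒≡⊎⊂ C⊆B
... | inj₁ refl = B∈
... | inj₂ C⊂B  = Lightest.chosen-down L B∈ C∈xs (p⊂q⇒∣p∣<∣q∣ C⊂B)

BalancedAt : ∀ {n} → Family n → Fin n → Family n → Set
BalancedAt S p Ŝ = Ŝ ⊆F S × IntersectionClosed Ŝ × ⊥ ∈F Ŝ × support S ∈F Ŝ
                   × 2 * cardAt p Ŝ ≡ card Ŝ
                   × (∀ {A} → A ∈F S → ¬ (A ∈F Ŝ) → p ∉ₛ A)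

half-of-subfamily : ∀ {n} (S Ŝ : Family n) (p : Fin n) → Ŝ ⊆F S
                  → 2 * cardAt p Ŝ ≡ card Ŝ
                  → (∀ {A} → A ∈F S → ¬ (A ∈F Ŝ) → p ∉ₛ A)
                  → 2 * cardAt p S ≤ card S
half-of-subfamily S Ŝ p Ŝ⊆S half outside-avoids-p = begin
    2 * cardAt p S ≤⟨ *-monoʳ-≤ 2 (unique-⊆-length _ _ (Unique.filter⁺ (p ∈?_) (unique S)) S_p⊆Ŝ_p) ⟩
    2 * cardAt p Ŝ ≡⟨ half ⟩
    card Ŝ         ≤⟨ unique-⊆-length _ _ (unique Ŝ) Ŝ⊆S ⟩
    card S         ∎
  where
    open ≤-Reasoning
    open import Data.List.Membership.DecPropositional (≡-dec Bool._≟_) using () renaming (_∈?_ to _∈F?_)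
    S_p⊆Ŝ_p : ∀ {A} → A ∈ filter (p ∈?_) (members S) → A ∈ filter (p ∈?_) (members Ŝ)
    S_p⊆Ŝ_p {A} A∈S_p with ∈-filter⁻ (p ∈?_) {xs = members S} A∈S_p | A ∈F? members Ŝ
    ... | A∈S , p∈A | yes A∈Ŝ = ∈-filter⁺ (p ∈?_) A∈Ŝ p∈A
    ... | A∈S , p∈A | no  A∉Ŝ = contradiction p∈A (outside-avoids-p A∈S A∉Ŝ)

member-of-nonempty : ∀ {A : Set} (xs : List A) → 0 < length xs → Σ A (_∈ xs)
member-of-nonempty (x ∷ _) _ = x , here refl

module HalvingConstruction {n} (S : Family n) (S-closed : IntersectionClosed S)
    (∅∈S : ⊥ ∈F S) (X∈S : support S ∈F S) (p : Fin n) (p∈X : p ∈ₛ support S)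
    (few : 2 * cardAt p S ≤ card S) where

  through avoiding : List (Subset n)
  through  = filter (p ∈?_) (members S)
  avoiding = filter (∁? (p ∈?_)) (members S)

  through-member : ∀ {A} → A ∈ through → A ∈F S × p ∈ₛ A
  through-member = ∈-filter⁻ (p ∈?_) {xs = members S}

  avoiding-member : ∀ {A} → A ∈ avoiding → A ∈F S × p ∉ₛ A
  avoiding-member = ∈-filter⁻ (∁? (p ∈?_)) {xs = members S}

  k : ℕ
  k = length through

  k≤|avoiding| : k ≤ length avoiding
  k≤|avoiding| = +-cancelˡ-≤ k k (length avoiding) (begin
      k + k                     ≡⟨ cong (k +_) (sym (+-identityʳ k)) ⟩
      2 * k                     ≤⟨ few ⟩
      card S                    ≡⟨ sym (length-filter-∁ (p ∈?_) (members S)) ⟩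
      k + length avoiding       ∎)
    where open ≤-Reasoning

  T : Lightest ∣_∣ avoiding k
  T = lightest ∣_∣ avoiding k (Unique.filter⁺ _ (unique S)) k≤|avoiding|
  open Lightest T

  chosen-member : ∀ {A} → A ∈ chosen → A ∈F S × p ∉ₛ A
  chosen-member A∈T = avoiding-member (chosen-⊆ A∈T)

  -- members of S below a member of T avoid p, hence lie in T
  below-chosen : ∀ {B C} → B ∈ chosen → C ∈F S → C ⊆ B → C ∈ chosen
  below-chosen B∈T C∈S C⊆B = lightest-⊆-closed T B∈T
    (∈-filter⁺ (∁? (p ∈?_)) C∈S (λ p∈C → proj₂ (chosen-member B∈T) (C⊆B p∈C))) C⊆B

  Ŝ : Family n
  Ŝ = family (through ++ chosen)
    (Unique.++⁺ (Unique.filter⁺ _ (unique S)) chosen-unique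
      λ (A∈S_p , A∈T) → proj₂ (chosen-member A∈T) (proj₂ (through-member A∈S_p)))

  Ŝ⊆S : Ŝ ⊆F S
  Ŝ⊆S A∈Ŝ with ∈-++⁻ through A∈Ŝ
  ... | inj₁ A∈S_p = proj₁ (through-member A∈S_p)
  ... | inj₂ A∈T   = proj₁ (chosen-member A∈T)

  -- S_p is closed as p ∈ A ∩ B; otherwise A ∩ B lies below a member of T
  Ŝ-closed : IntersectionClosed Ŝ
  Ŝ-closed {A} {B} A∈Ŝ B∈Ŝ = by-parts (∈-++⁻ through A∈Ŝ) (∈-++⁻ through B∈Ŝ)
    where
      A∩B∈S : (A ∩ B) ∈F S
      A∩B∈S = S-closed (Ŝ⊆S A∈Ŝ) (Ŝ⊆S B∈Ŝ)
      by-parts : A ∈ through ⊎ A ∈ chosen → B ∈ through ⊎ B ∈ chosen → (A ∩ B) ∈F Ŝ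
      by-parts (inj₁ A∈S_p) (inj₁ B∈S_p) = ∈-++⁺ˡ (∈-filter⁺ (p ∈?_) A∩B∈S
        (x∈p∩q⁺ (proj₂ (through-member A∈S_p) , proj₂ (through-member B∈S_p))))
      by-parts _            (inj₂ B∈T)   = ∈-++⁺ʳ through (below-chosen B∈T A∩B∈S (p∩q⊆q A B))
      by-parts (inj₂ A∈T)   (inj₁ _)     = ∈-++⁺ʳ through (below-chosen A∈T A∩B∈S (p∩q⊆p A B))

  X∈S_p : support S ∈ through
  X∈S_p = ∈-filter⁺ (p ∈?_) X∈S p∈X

  -- T is non-empty (it is as large as S_p ∋ X_S), and ∅ lies below its members
  ∅∈Ŝ : ⊥ ∈F Ŝ
  ∅∈Ŝ with B , B∈T ← member-of-nonempty chosen (subst (0 <_) (sym chosen-length) (∈-length X∈S_p))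
    = ∈-++⁺ʳ through (below-chosen B∈T ∅∈S ⊥⊆)

  Ŝ_p≡S_p : filter (p ∈?_) (through ++ chosen) ≡ through
  Ŝ_p≡S_p = begin
      filter (p ∈?_) (through ++ chosen)                  ≡⟨ filter-++ (p ∈?_) through chosen ⟩
      filter (p ∈?_) through ++ filter (p ∈?_) chosen     ≡⟨ cong₂ _++_
                                                                 (filter-all (p ∈?_) (all-filter (p ∈?_) (members S)))
                                                                 (filter-none (p ∈?_) (All.tabulate (proj₂ ∘ chosen-member))) ⟩
      through ++ []                                       ≡⟨ ++-identityʳ through ⟩
      through                                             ∎
    where open ≡-Reasoning

  Ŝ-half : 2 * cardAt p Ŝ ≡ card Ŝ
  Ŝ-half = begin
      2 * cardAt p Ŝ      ≡⟨ cong (λ xs → 2 * length xs) Ŝ_p≡S_p ⟩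
      k + (k + 0)         ≡⟨ cong (k +_) (trans (+-identityʳ k) (sym chosen-length)) ⟩
      k + length chosen   ≡⟨ sym (length-++ through) ⟩
      card Ŝ              ∎
    where open ≡-Reasoning

  Ŝ-balanced : BalancedAt S p Ŝ
  Ŝ-balanced = Ŝ⊆S , Ŝ-closed , ∅∈Ŝ , ∈-++⁺ˡ X∈S_p , Ŝ-half
             , λ A∈S A∉Ŝ p∈A → A∉Ŝ (∈-++⁺ˡ (∈-filter⁺ (p ∈?_) A∈S p∈A))

-- The theorem.
lemma1 : ∀ {n} (S : Family n) → IntersectionClosed S → 1 < card S
         → ⊥ ∈F S → support S ∈F S
         → (p : Fin n) → p ∈ₛ support S
         → (2 * cardAt p S ≤ card S)
           ⇔ Σ (Family n) (λ Ŝ → Ŝ ⊆F S × IntersectionClosed Ŝ × ⊥ ∈F Ŝ × support S ∈F Ŝ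
                 × 2 * cardAt p Ŝ ≡ card Ŝ
                 × (∀ {A} → A ∈F S → ¬ (A ∈F Ŝ) → p ∉ₛ A))
lemma1 {n} S S-closed _ ∅∈S X∈S p p∈X = mk⇔ forward backward
  where
    forward : 2 * cardAt p S ≤ card S → Σ (Family n) (BalancedAt S p)
    forward few = Ŝ , Ŝ-balanced
      where open HalvingConstruction S S-closed ∅∈S X∈S p p∈X few

    backward : Σ (Family n) (BalancedAt S p) → 2 * cardAt p S ≤ card S
    backward (Ŝ , Ŝ⊆S , _ , _ , _ , half , outside-avoids-p) =
      half-of-subfamily S Ŝ p Ŝ⊆S half outside-avoids-p
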